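{- For every integer $d>0$ there exist an integral projective curve $X\subseteq\mathbb{P}^2_{\mathbb{Q}}$ of degree $d$ and an integer $B\geq 1$ such that $$\tfrac{1}{5}d^2B^{2/d}\leq N(X,B).$$
   Context: The height of a rational point $x\in\mathbb{P}^n(\mathbb{Q})$ is $H(x)=\max(|x_0|,\dots,|x_n|)$, where $(x_0,\dots,x_n)$ are integer homogeneous coordinates of $x$ with greatest common divisor $1$. For a subvariety $X\subseteq\mathbb{P}^n_{\mathbb{Q}}$, $N(X,B)$ denotes the number of points $x\in X(\mathbb{Q})$ with $H(x)\leq B$. -}

module Defs where

open import Data.Nat as ℕ using (ℕ; zero; suc; _∸_)
open import Data.Nat.GCD using (gcd)
open import Data.Integer as ℤ using (ℤ; +_; -[1+_]; ∣_∣)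
open import Data.Rational as ℚ using (ℚ; 0ℚ; 1ℚ)
open import Data.Rational.Properties using () renaming (_≟_ to _≟ℚ_)
import Data.List
open import Data.List using (List; []; _∷_; map; concatMap; filter; length; foldr; upTo)
open import Data.Product using (Σ; ∃; _×_; _,_; proj₁)
open import Relation.Binary.PropositionalEquality using (_≡_; _≢_)
open import Relation.Nullary using (¬_; Dec; yes; no)
import Relation.Nullary
open import Data.Bool
open import Data.Bool using (Bool; true; false; _∧_; if_then_else_)

-- Polynomials in ℚ[x₀,x₁,x₂], represented by their coefficient function
-- (coeff i j k = coefficient of x₀^i x₁^j x₂^k) together with a bound on
-- the support (all exponents ≤ bound).

record Poly : Set where
  field
    coeff   : ℕ → ℕ → ℕ → ℚ
    bound   : ℕ
    support : ∀ i j k → coeff i j k ≢ 0ℚ →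
              (i ℕ.≤ bound) × (j ℕ.≤ bound) × (k ℕ.≤ bound)
open Poly public

sumℚ : ℕ → (ℕ → ℚ) → ℚ
sumℚ zero    f = f 0
sumℚ (suc n) f = sumℚ n f ℚ.+ f (suc n)

mulCoeff : Poly → Poly → ℕ → ℕ → ℕ → ℚ
mulCoeff G H i j k =
  sumℚ i λ a → sumℚ j λ b → sumℚ k λ c →
    coeff G a b c ℚ.* coeff H (i ∸ a) (j ∸ b) (k ∸ c)

IsProduct : Poly → Poly → Poly → Set
IsProduct F G H = ∀ i j k → coeff F i j k ≡ mulCoeff G H i j k

NonConstant : Poly → Set
NonConstant G = ∃ λ i → ∃ λ j → ∃ λ k → (0 ℕ.< i ℕ.+ j ℕ.+ k) × (coeff G i j k ≢ 0ℚ)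

Irreducible : Poly → Set
Irreducible F = NonConstant F × (∀ G H → IsProduct F G H → ¬ (NonConstant G × NonConstant H))

HomogeneousOfDegree : ℕ → Poly → Set
HomogeneousOfDegree d F =
  (∃ λ i → ∃ λ j → ∃ λ k → coeff F i j k ≢ 0ℚ) ×
  (∀ i j k → coeff F i j k ≢ 0ℚ → i ℕ.+ j ℕ.+ k ≡ d)

powℚ : ℚ → ℕ → ℚ
powℚ q zero    = 1ℚ
powℚ q (suc n) = q ℚ.* powℚ q n

toℚ : ℤ → ℚ
toℚ z = z ℚ./ 1

eval : Poly → ℤ → ℤ → ℤ → ℚ
eval F x y z =
  sumℚ (bound F) λ i → sumℚ (bound F) λ j → sumℚ (bound F) λ k →
    coeff F i j k ℚ.* (powℚ (toℚ x) i ℚ.* (powℚ (toℚ y) j ℚ.* powℚ (toℚ z) k))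

-- A point of ℙ²(ℚ) is represented uniquely by integer coordinates
-- (x₀,x₁,x₂) with gcd 1 whose first nonzero coordinate is positive;
-- its height is max |xᵢ|.

range : ℕ → List ℤ
range B = map (λ n → + n) (upTo (suc B)) Data.List.++ map (λ n → -[1+ n ]) (upTo B)

triples : ℕ → List (ℤ × ℤ × ℤ)
triples B = concatMap (λ x → concatMap (λ y → map (λ z → x , y , z) (range B)) (range B)) (range B)

isPos : ℤ → Bool
isPos (+ suc _) = true
isPos _         = false

isZero : ℤ → Bool
isZero (+ zero) = true
isZero _        = false

normalised : ℤ × ℤ × ℤ → Bool
normalised (x , y , z) =
  isPos x Data.Bool.∨ (isZero x ∧ (isPos y Data.Bool.∨ (isZero y ∧ isPos z)))

isPrimitive : ℤ × ℤ × ℤ → Bool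
isPrimitive (x , y , z) = Relation.Nullary.does (gcd (gcd ∣ x ∣ ∣ y ∣) ∣ z ∣ ℕ.≟ 1)

onCurve : Poly → ℤ × ℤ × ℤ → Bool
onCurve F (x , y , z) = Relation.Nullary.does (eval F x y z ≟ℚ 0ℚ)

count : {A : Set} → (A → Bool) → List A → ℕ
count p []       = 0
count p (a ∷ as) = if p a then suc (count p as) else count p as

N : Poly → ℕ → ℕ
N F B = count (λ t → normalised t ∧ (isPrimitive t ∧ onCurve F t)) (triples B)

-- Write d = n + 1, take  Fₙ = x₁ ∏ᵢ₌₁ⁿ (x₀ - i x₂) + x₂ ∏ⱼ₌₁ⁿ (x₁ - j x₂)  and B = n + 1.
-- Fₙ vanishes on the grid (i : j : 1), 1 ≤ i, j ≤ n, and at (1 : 0 : 0): these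
-- are n² + 1 points of height ≤ n + 1, and an elementary inequality gives the bound.
-- Irreducibility rests on monomial orders: the leading monomial of a product is
-- the sum of the leading monomials of the factors.  Ordering by degree (and by
-- minus the degree) shows that factors of a homogeneous polynomial are
-- homogeneous; ordering by the weight (n+1, 0, n) shows that a factorisation
-- splits the edge from x₀ⁿx₁ to x₂ⁿ⁺¹ of the Newton polygon of Fₙ, which has no
-- interior lattice point, so one factor is constant.
module Submission where

open import Defs
open import Data.Nat using (ℕ; _≤_; _<_; _*_; _^_)
open import Data.Product using (∃; _×_)

open import Data.Nat using (zero; suc; _+_; _∸_; z≤n; s≤s)
import Data.Nat.Properties as ℕP
open import Data.Nat.GCD using (gcd; gcd-zeroʳ)
open import Data.Nat.Solver using () renaming (module +-*-Solver to NSolver)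
open import Data.Integer as ℤ using (ℤ; +_)
import Data.Integer.Properties as ℤP
open import Data.Integer.Solver using () renaming (module +-*-Solver to ZSolver)
open import Data.Rational as ℚ using (ℚ; 0ℚ; 1ℚ)
import Data.Rational.Properties as ℚP
open import Data.Rational.Solver using () renaming (module +-*-Solver to QSolver)
open import Data.Bool using (Bool; true; false; _∧_)
open import Data.Product using (Σ; _,_; proj₁; proj₂; map₂)
open import Data.Sum as Sum using (_⊎_; inj₁; inj₂)
open import Data.Empty using (⊥; ⊥-elim)
open import Data.Vec using (Vec; []; _∷_; zipWith; head)
open import Data.List using (List; []; _∷_; map; concatMap; upTo; length; cartesianProductWith)
open import Data.List.Properties using (length-++; length-map; length-upTo)
open import Data.List.Membership.Propositional using (_∈_; lose)
open import Data.List.Membership.Propositional.Properties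
  using (∈-map⁺; ∈-upTo⁺; ∈-upTo⁻; ∈-concatMap⁺; ∈-++⁺ˡ; ∈-cartesianProductWith⁻)
open import Data.List.Relation.Unary.Any using (here; there)
import Data.List.Relation.Unary.All as All
open import Data.List.Relation.Unary.AllPairs using (_∷_)
open import Data.List.Relation.Unary.Unique.Propositional using (Unique)
open import Data.List.Relation.Unary.Unique.Propositional.Properties using (cartesianProductWith⁺; upTo⁺)
open import Function using (_∘_)
open import Relation.Binary.Definitions using (tri<; tri≈; tri>)
open import Relation.Binary.PropositionalEquality
open import Relation.Nullary using (¬_; Dec; yes; no; ¬?)
open import Relation.Nullary.Decidable using (dec-true)

sum-cong : ∀ n {f g : ℕ → ℚ} → (∀ a → a ≤ n → f a ≡ g a) → sumℚ n f ≡ sumℚ n g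
sum-cong zero    f≗g = f≗g 0 z≤n
sum-cong (suc n) f≗g =
  cong₂ ℚ._+_ (sum-cong n λ a a≤n → f≗g a (ℕP.m≤n⇒m≤1+n a≤n)) (f≗g (suc n) ℕP.≤-refl)

sum-zero : ∀ n {f : ℕ → ℚ} → (∀ a → a ≤ n → f a ≡ 0ℚ) → sumℚ n f ≡ 0ℚ
sum-zero n f≗0 = trans (sum-cong n f≗0) (sum-const0 n)
  where
  sum-const0 : ∀ n → sumℚ n (λ _ → 0ℚ) ≡ 0ℚ
  sum-const0 zero    = refl
  sum-const0 (suc n) = cong (ℚ._+ 0ℚ) (sum-const0 n)

sum-+ : ∀ n (f g : ℕ → ℚ) → sumℚ n (λ a → f a ℚ.+ g a) ≡ sumℚ n f ℚ.+ sumℚ n g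
sum-+ zero    f g = refl
sum-+ (suc n) f g =
  trans (cong (ℚ._+ (f (suc n) ℚ.+ g (suc n))) (sum-+ n f g))
        (interchange (sumℚ n f) (sumℚ n g) (f (suc n)) (g (suc n)))
  where
  open QSolver
  interchange : ∀ a b c d → (a ℚ.+ b) ℚ.+ (c ℚ.+ d) ≡ (a ℚ.+ c) ℚ.+ (b ℚ.+ d)
  interchange = solve 4 (λ a b c d → (a :+ b) :+ (c :+ d) := (a :+ c) :+ (b :+ d)) refl

sum-scale : ∀ n q (f : ℕ → ℚ) → sumℚ n (λ a → q ℚ.* f a) ≡ q ℚ.* sumℚ n f
sum-scale zero    q f = refl
sum-scale (suc n) q f =
  trans (cong (ℚ._+ (q ℚ.* f (suc n))) (sum-scale n q f))
        (sym (ℚP.*-distribˡ-+ q (sumℚ n f) (f (suc n))))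

sum-single : ∀ n a₀ (f : ℕ → ℚ) → a₀ ≤ n → (∀ a → a ≤ n → a ≢ a₀ → f a ≡ 0ℚ) → sumℚ n f ≡ f a₀
sum-single zero .zero f z≤n _ = refl
sum-single (suc n) a₀ f a₀≤ f≗0 with a₀ ℕP.≟ suc n
... | yes refl =
  trans (cong (ℚ._+ f (suc n)) (sum-zero n λ a a≤n → f≗0 a (ℕP.m≤n⇒m≤1+n a≤n) (ℕP.<⇒≢ (s≤s a≤n))))
        (ℚP.+-identityˡ (f (suc n)))
... | no a₀≢ =
  trans (cong₂ ℚ._+_
           (sum-single n a₀ f (ℕP.≤-pred (ℕP.≤∧≢⇒< a₀≤ a₀≢)) λ a a≤n → f≗0 a (ℕP.m≤n⇒m≤1+n a≤n))
           (f≗0 (suc n) ℕP.≤-refl (a₀≢ ∘ sym)))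
        (ℚP.+-identityʳ (f a₀))

sum-nonzero : ∀ n (f : ℕ → ℚ) → sumℚ n f ≢ 0ℚ → ∃ λ a → a ≤ n × f a ≢ 0ℚ
sum-nonzero zero    f Σ≢0 = 0 , z≤n , Σ≢0
sum-nonzero (suc n) f Σ≢0 with f (suc n) ℚP.≟ 0ℚ
... | no fn≢0 = suc n , ℕP.≤-refl , fn≢0
... | yes fn≡0 with sum-nonzero n f (λ Σn≡0 → Σ≢0 (cong₂ ℚ._+_ Σn≡0 fn≡0))
...   | a , a≤n , fa≢0 = a , ℕP.m≤n⇒m≤1+n a≤n , fa≢0

sum-unfoldˡ : ∀ n (f : ℕ → ℚ) → sumℚ (suc n) f ≡ f 0 ℚ.+ sumℚ n (f ∘ suc)
sum-unfoldˡ zero    f = refl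
sum-unfoldˡ (suc n) f =
  trans (cong (ℚ._+ f (suc (suc n))) (sum-unfoldˡ n f)) (ℚP.+-assoc (f 0) (sumℚ n (f ∘ suc)) _)

*-≢0 : ∀ p q → p ≢ 0ℚ → q ≢ 0ℚ → p ℚ.* q ≢ 0ℚ
*-≢0 p q p≢0 q≢0 pq≡0 = q≢0 (begin
    q                    ≡⟨ sym (ℚP.*-identityˡ q) ⟩
    1ℚ ℚ.* q             ≡⟨ cong (ℚ._* q) (sym (ℚP.*-inverseˡ p)) ⟩
    (ℚ.1/ p) ℚ.* p ℚ.* q ≡⟨ ℚP.*-assoc (ℚ.1/ p) p q ⟩
    ℚ.1/ p ℚ.* (p ℚ.* q) ≡⟨ cong (ℚ.1/ p ℚ.*_) pq≡0 ⟩
    ℚ.1/ p ℚ.* 0ℚ        ≡⟨ ℚP.*-zeroʳ (ℚ.1/ p) ⟩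
    0ℚ                   ∎)
  where
  open ≡-Reasoning
  instance
    p-nonZero : ℚ.NonZero p
    p-nonZero = ℚ.≢-nonZero p≢0

*-≢0ˡ : ∀ p q → p ℚ.* q ≢ 0ℚ → p ≢ 0ℚ
*-≢0ˡ p q pq≢0 refl = pq≢0 (ℚP.*-zeroˡ q)

*-≢0ʳ : ∀ p q → p ℚ.* q ≢ 0ℚ → q ≢ 0ℚ
*-≢0ʳ p q pq≢0 refl = pq≢0 (ℚP.*-zeroʳ p)

-- The lexicographic order on ℤⁿ; it is total and compatible with
-- addition, which is all a monomial order needs.

infix 4 _<ₗ_ _≤ₗ_

data _<ₗ_ : ∀ {n} → Vec ℤ n → Vec ℤ n → Set where
  here  : ∀ {n x y} {xs ys : Vec ℤ n} → x ℤ.< y → (x ∷ xs) <ₗ (y ∷ ys)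
  there : ∀ {n x} {xs ys : Vec ℤ n} → xs <ₗ ys → (x ∷ xs) <ₗ (x ∷ ys)

_≤ₗ_ : ∀ {n} → Vec ℤ n → Vec ℤ n → Set
xs ≤ₗ ys = xs <ₗ ys ⊎ xs ≡ ys

_⊕_ : ∀ {n} → Vec ℤ n → Vec ℤ n → Vec ℤ n
_⊕_ = zipWith ℤ._+_

<ₗ-irrefl : ∀ {n} {xs : Vec ℤ n} → ¬ (xs <ₗ xs)
<ₗ-irrefl (here x<x) = ℤP.<-irrefl refl x<x
<ₗ-irrefl (there xs<xs) = <ₗ-irrefl xs<xs

<ₗ-trans : ∀ {n} {xs ys zs : Vec ℤ n} → xs <ₗ ys → ys <ₗ zs → xs <ₗ zs
<ₗ-trans (here p)  (here q)  = here (ℤP.<-trans p q)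
<ₗ-trans (here p)  (there _) = here p
<ₗ-trans (there _) (here q)  = here q
<ₗ-trans (there p) (there q) = there (<ₗ-trans p q)

≤ₗ-trans : ∀ {n} {xs ys zs : Vec ℤ n} → xs ≤ₗ ys → ys ≤ₗ zs → xs ≤ₗ zs
≤ₗ-trans (inj₁ p)    (inj₁ q)    = inj₁ (<ₗ-trans p q)
≤ₗ-trans (inj₁ p)    (inj₂ refl) = inj₁ p
≤ₗ-trans (inj₂ refl) q           = q

≤ₗ-antisym : ∀ {n} {xs ys : Vec ℤ n} → xs ≤ₗ ys → ys ≤ₗ xs → xs ≡ ys
≤ₗ-antisym (inj₂ xs≡ys) _           = xs≡ys
≤ₗ-antisym (inj₁ _)     (inj₂ ys≡xs) = sym ys≡xs
≤ₗ-antisym (inj₁ p)     (inj₁ q)    = ⊥-elim (<ₗ-irrefl (<ₗ-trans p q))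

∷-mono-≤ₗ : ∀ {n} x {xs ys : Vec ℤ n} → xs ≤ₗ ys → (x ∷ xs) ≤ₗ (x ∷ ys)
∷-mono-≤ₗ x (inj₁ p)    = inj₁ (there p)
∷-mono-≤ₗ x (inj₂ refl) = inj₂ refl

≤ₗ-total : ∀ {n} (xs ys : Vec ℤ n) → xs ≤ₗ ys ⊎ ys ≤ₗ xs
≤ₗ-total [] [] = inj₁ (inj₂ refl)
≤ₗ-total (x ∷ xs) (y ∷ ys) with ℤP.<-cmp x y
... | tri< x<y _ _ = inj₁ (inj₁ (here x<y))
... | tri> _ _ y<x = inj₂ (inj₁ (here y<x))
... | tri≈ _ refl _ with ≤ₗ-total xs ys
...   | inj₁ xs≤ys = inj₁ (∷-mono-≤ₗ x xs≤ys)
...   | inj₂ ys≤xs = inj₂ (∷-mono-≤ₗ x ys≤xs)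

⊕-comm : ∀ {n} (xs ys : Vec ℤ n) → xs ⊕ ys ≡ ys ⊕ xs
⊕-comm []       []       = refl
⊕-comm (x ∷ xs) (y ∷ ys) = cong₂ _∷_ (ℤP.+-comm x y) (⊕-comm xs ys)

⊕-mono-<≤ : ∀ {n} {xs ys us vs : Vec ℤ n} → xs <ₗ ys → us ≤ₗ vs → xs ⊕ us <ₗ ys ⊕ vs
⊕-mono-<≤                 (here p)  (inj₁ (here q))  = here (ℤP.+-mono-< p q)
⊕-mono-<≤ {us = u ∷ _}    (here p)  (inj₁ (there _)) = here (ℤP.+-monoˡ-< u p)
⊕-mono-<≤ {us = u ∷ _}    (here p)  (inj₂ refl)      = here (ℤP.+-monoˡ-< u p)
⊕-mono-<≤ {xs = x ∷ _}    (there _) (inj₁ (here q))  = here (ℤP.+-monoʳ-< x q)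
⊕-mono-<≤                 (there p) (inj₁ (there q)) = there (⊕-mono-<≤ p (inj₁ q))
⊕-mono-<≤ {us = _ ∷ _}    (there p) (inj₂ refl)      = there (⊕-mono-<≤ p (inj₂ refl))

⊕-mono-≤ : ∀ {n} {xs ys us vs : Vec ℤ n} → xs ≤ₗ ys → us ≤ₗ vs → xs ⊕ us ≤ₗ ys ⊕ vs
⊕-mono-≤ (inj₁ p) q = inj₁ (⊕-mono-<≤ p q)
⊕-mono-≤ {xs = xs} {us = us} {vs} (inj₂ refl) (inj₁ q) =
  inj₁ (subst₂ _<ₗ_ (⊕-comm us xs) (⊕-comm vs xs) (⊕-mono-<≤ q (inj₂ refl)))
⊕-mono-≤ (inj₂ refl) (inj₂ refl) = inj₂ refl

⊕-cancel-≤ : ∀ {n} {xs ys us vs : Vec ℤ n} → xs ≤ₗ ys → us ≤ₗ vs → xs ⊕ us ≡ ys ⊕ vs → xs ≡ ys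
⊕-cancel-≤ (inj₂ xs≡ys) _ _ = xs≡ys
⊕-cancel-≤ (inj₁ p) q sums≡ = ⊥-elim (<ₗ-irrefl (subst (_<ₗ _) sums≡ (⊕-mono-<≤ p q)))

head-mono-≤ : ∀ {n} {xs ys : Vec ℤ (suc n)} → xs ≤ₗ ys → head xs ℤ.≤ head ys
head-mono-≤ (inj₁ (here p))  = ℤP.<⇒≤ p
head-mono-≤ (inj₁ (there _)) = ℤP.≤-refl
head-mono-≤ (inj₂ refl)      = ℤP.≤-refl

list-maximum : ∀ {A : Set} {n} (K : A → Vec ℤ n) {P : A → Set} → (∀ x → Dec (P x)) → (L : List A) →
  (∀ x → x ∈ L → ¬ P x) ⊎ (Σ A λ m → P m × (∀ x → x ∈ L → P x → K x ≤ₗ K m))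
list-maximum K P? [] = inj₁ (λ _ ())
list-maximum K P? (y ∷ L) with list-maximum K P? L | P? y
... | inj₁ none | no ¬Py = inj₁ λ { x (here refl) → ¬Py ; x (there x∈) → none x x∈ }
... | inj₁ none | yes Py =
  inj₂ (y , Py , λ { x (here refl) _ → inj₂ refl ; x (there x∈) Px → ⊥-elim (none x x∈ Px) })
... | inj₂ (m , Pm , max) | no ¬Py =
  inj₂ (m , Pm , λ { x (here refl) Py → ⊥-elim (¬Py Py) ; x (there x∈) Px → max x x∈ Px })
... | inj₂ (m , Pm , max) | yes Py with ≤ₗ-total (K y) (K m)
...   | inj₁ y≤m = inj₂ (m , Pm , λ { x (here refl) _ → y≤m ; x (there x∈) Px → max x x∈ Px })
...   | inj₂ m≤y =
  inj₂ (y , Py , λ { x (here refl) _ → inj₂ refl ; x (there x∈) Px → ≤ₗ-trans (max x x∈ Px) m≤y })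

Mon : Set
Mon = ℕ × ℕ × ℕ

_+ᵐ_ : Mon → Mon → Mon
(a , b , c) +ᵐ (a′ , b′ , c′) = (a + a′ , b + b′ , c + c′)

deg : Mon → ℕ
deg (a , b , c) = a + b + c

deg-+ᵐ : ∀ e e′ → deg (e +ᵐ e′) ≡ deg e + deg e′
deg-+ᵐ (a , b , c) (a′ , b′ , c′) =
  solve 6 (λ a b c a′ b′ c′ → a :+ a′ :+ (b :+ b′) :+ (c :+ c′) := a :+ b :+ c :+ (a′ :+ b′ :+ c′))
    refl a b c a′ b′ c′
  where open NSolver

Weight : Set
Weight = ℤ × ℤ × ℤ

⟨_,_⟩ : Weight → Mon → ℤ
⟨ (p , q , r) , (a , b , c) ⟩ = p ℤ.* + a ℤ.+ q ℤ.* + b ℤ.+ r ℤ.* + c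

⟨⟩-+ᵐ : ∀ w e e′ → ⟨ w , e +ᵐ e′ ⟩ ≡ ⟨ w , e ⟩ ℤ.+ ⟨ w , e′ ⟩
⟨⟩-+ᵐ (p , q , r) (a , b , c) (a′ , b′ , c′)
  rewrite ℤP.pos-+ a a′ | ℤP.pos-+ b b′ | ℤP.pos-+ c c′ =
  solve 9 (λ p q r a b c a′ b′ c′ →
             p :* (a :+ a′) :+ q :* (b :+ b′) :+ r :* (c :+ c′)
          := p :* a :+ q :* b :+ r :* c :+ (p :* a′ :+ q :* b′ :+ r :* c′))
    refl p q r (+ a) (+ b) (+ c) (+ a′) (+ b′) (+ c′)
  where open ZSolver

⟨⟩-ℕ : ∀ p q r e → ⟨ (+ p , + q , + r) , e ⟩ ≡ + (p * proj₁ e + q * proj₁ (proj₂ e) + r * proj₂ (proj₂ e))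
⟨⟩-ℕ p q r (a , b , c) = sym (begin
  + (p * a + q * b + r * c)              ≡⟨ ℤP.pos-+ (p * a + q * b) (r * c) ⟩
  + (p * a + q * b) ℤ.+ + (r * c)        ≡⟨ cong (ℤ._+ + (r * c)) (ℤP.pos-+ (p * a) (q * b)) ⟩
  + (p * a) ℤ.+ + (q * b) ℤ.+ + (r * c)
    ≡⟨ cong₂ ℤ._+_ (cong₂ ℤ._+_ (ℤP.pos-* p a) (ℤP.pos-* q b)) (ℤP.pos-* r c) ⟩
  ⟨ (+ p , + q , + r) , (a , b , c) ⟩    ∎)
  where open ≡-Reasoning

-- The monomial order given by two weights w₁, w₂: compare ⟨w₁,e⟩, then
-- ⟨w₂,e⟩, then the exponents lexicographically.  It is a total order
-- (key is injective) compatible with multiplication of monomials.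
key : Weight → Weight → Mon → Vec ℤ 5
key w₁ w₂ e@(a , b , c) = ⟨ w₁ , e ⟩ ∷ ⟨ w₂ , e ⟩ ∷ + a ∷ + b ∷ + c ∷ []

key-+ᵐ : ∀ w₁ w₂ e e′ → key w₁ w₂ (e +ᵐ e′) ≡ key w₁ w₂ e ⊕ key w₁ w₂ e′
key-+ᵐ w₁ w₂ e e′ rewrite ⟨⟩-+ᵐ w₁ e e′ | ⟨⟩-+ᵐ w₂ e e′ = refl

key-injective : ∀ w₁ w₂ {e e′} → key w₁ w₂ e ≡ key w₁ w₂ e′ → e ≡ e′
key-injective w₁ w₂ {a , b , c} {.a , .b , .c} refl = refl

Coef : Set
Coef = ℕ → ℕ → ℕ → ℚ

at : Coef → Mon → ℚ
at C (a , b , c) = C a b c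

InSupport : Coef → Mon → Set
InSupport C e = at C e ≢ 0ℚ

record Leading (w₁ w₂ : Weight) (C : Coef) (m : Mon) : Set where
  constructor leading
  field
    in-support : InSupport C m
    maximal    : ∀ e → InSupport C e → key w₁ w₂ e ≤ₗ key w₁ w₂ m
open Leading

leading-unique : ∀ {w₁ w₂ C m m′} → Leading w₁ w₂ C m → Leading w₁ w₂ C m′ → m ≡ m′
leading-unique {w₁} {w₂} (leading m∈ m-max) (leading m′∈ m′-max) =
  key-injective w₁ w₂ (≤ₗ-antisym (m′-max _ m∈) (m-max _ m′∈))

leading-same-face : ∀ {w v v′ C m m′} → Leading w v C m → Leading w v′ C m′ → ⟨ w , m ⟩ ≡ ⟨ w , m′ ⟩
leading-same-face (leading m∈ m-max) (leading m′∈ m′-max) =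
  ℤP.≤-antisym (head-mono-≤ (m′-max _ m∈)) (head-mono-≤ (m-max _ m′∈))

-- The monomials x₀ᵃ x₁ᵇ x₂ᶜ with all exponents ≤ n, as a list; it contains the
-- support of every polynomial with bound n, so maxima can be searched in it.
cube-row : ℕ → ℕ → ℕ → List Mon
cube-row n a b = map (λ c → (a , b , c)) (upTo (suc n))

cube-plane : ℕ → ℕ → List Mon
cube-plane n a = concatMap (cube-row n a) (upTo (suc n))

cube : ℕ → List Mon
cube n = concatMap (cube-plane n) (upTo (suc n))

∈-concatMap : ∀ {A B : Set} (f : A → List B) {x xs y} → x ∈ xs → y ∈ f x → y ∈ concatMap f xs
∈-concatMap f x∈ y∈ = ∈-concatMap⁺ f (lose x∈ y∈)

support-in-cube : ∀ (G : Poly) e → InSupport (coeff G) e → e ∈ cube (bound G)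
support-in-cube G (a , b , c) e∈ with support G a b c e∈
... | a≤ , b≤ , c≤ =
  ∈-concatMap (cube-plane (bound G)) (∈-upTo⁺ (s≤s a≤))
    (∈-concatMap (cube-row (bound G) a) (∈-upTo⁺ (s≤s b≤)) (∈-map⁺ (λ c → (a , b , c)) (∈-upTo⁺ (s≤s c≤))))

leading-exists : ∀ w₁ w₂ (G : Poly) {e} → InSupport (coeff G) e → ∃ λ m → Leading w₁ w₂ (coeff G) m
leading-exists w₁ w₂ G {e} e∈
  with list-maximum (key w₁ w₂) (λ e → ¬? (at (coeff G) e ℚP.≟ 0ℚ)) (cube (bound G))
... | inj₁ none = ⊥-elim (none e (support-in-cube G e e∈) e∈)
... | inj₂ (m , m∈ , m-max) = m , leading m∈ λ e e∈ → m-max e (support-in-cube G e e∈) e∈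

*-≡0 : ∀ p q → (p ≢ 0ℚ → q ≢ 0ℚ → ⊥) → p ℚ.* q ≡ 0ℚ
*-≡0 p q not-both with p ℚP.≟ 0ℚ | q ℚP.≟ 0ℚ
... | yes refl | _        = ℚP.*-zeroˡ q
... | no _     | yes refl = ℚP.*-zeroʳ p
... | no p≢0   | no q≢0   = ⊥-elim (not-both p≢0 q≢0)

+ᵐ-∸ : ∀ {a b c i j k} → a ≤ i → b ≤ j → c ≤ k → (a , b , c) +ᵐ (i ∸ a , j ∸ b , k ∸ c) ≡ (i , j , k)
+ᵐ-∸ a≤ b≤ c≤ = cong₂ _,_ (ℕP.m+[n∸m]≡n a≤) (cong₂ _,_ (ℕP.m+[n∸m]≡n b≤) (ℕP.m+[n∸m]≡n c≤))

sum³-single : ∀ i j k (T : ℕ → ℕ → ℕ → ℚ) {a₀ b₀ c₀} → a₀ ≤ i → b₀ ≤ j → c₀ ≤ k →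
  (∀ a b c → a ≤ i → b ≤ j → c ≤ k → (a , b , c) ≢ (a₀ , b₀ , c₀) → T a b c ≡ 0ℚ) →
  sumℚ i (λ a → sumℚ j λ b → sumℚ k λ c → T a b c) ≡ T a₀ b₀ c₀
sum³-single i j k T {a₀} {b₀} {c₀} a₀≤ b₀≤ c₀≤ T≗0 =
  trans (sum-single i a₀ _ a₀≤ λ a a≤ a≢ →
           sum-zero j λ b b≤ → sum-zero k λ c c≤ → T≗0 a b c a≤ b≤ c≤ (a≢ ∘ cong proj₁))
 (trans (sum-single j b₀ _ b₀≤ λ b b≤ b≢ →
           sum-zero k λ c c≤ → T≗0 a₀ b c a₀≤ b≤ c≤ (b≢ ∘ cong (proj₁ ∘ proj₂)))
        (sum-single k c₀ _ c₀≤ λ c c≤ c≢ → T≗0 a₀ b₀ c a₀≤ b₀≤ c≤ (c≢ ∘ cong (proj₂ ∘ proj₂))))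

module _ {w₁ w₂ : Weight} {G H : Poly} where

  private
    K : Mon → Vec ℤ 5
    K = key w₁ w₂

  mulCoeff-below : ∀ {mG mH} → Leading w₁ w₂ (coeff G) mG → Leading w₁ w₂ (coeff H) mH →
    ∀ i j k → mulCoeff G H i j k ≢ 0ℚ → K (i , j , k) ≤ₗ K mG ⊕ K mH
  mulCoeff-below {mG} {mH} (leading _ G-max) (leading _ H-max) i j k GH≢0
    with sum-nonzero i _ GH≢0
  ... | a , a≤ , ≢0 with sum-nonzero j _ ≢0
  ... | b , b≤ , ≢0′ with sum-nonzero k _ ≢0′
  ... | c , c≤ , term≢0 = subst (_≤ₗ K mG ⊕ K mH) key≡
    (⊕-mono-≤ (G-max (a , b , c) (*-≢0ˡ (coeff G a b c) _ term≢0))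
              (H-max (i ∸ a , j ∸ b , k ∸ c) (*-≢0ʳ (coeff G a b c) _ term≢0)))
    where
    key≡ : K (a , b , c) ⊕ K (i ∸ a , j ∸ b , k ∸ c) ≡ K (i , j , k)
    key≡ = trans (sym (key-+ᵐ w₁ w₂ (a , b , c) _)) (cong K (+ᵐ-∸ a≤ b≤ c≤))

  -- The coefficient of G·H at mG + mH is the product of the leading
  -- coefficients: no other pair of monomials has key sum K mG ⊕ K mH.
  mulCoeff-leading : ∀ {mG mH} → Leading w₁ w₂ (coeff G) mG → Leading w₁ w₂ (coeff H) mH →
    at (mulCoeff G H) (mG +ᵐ mH) ≡ at (coeff G) mG ℚ.* at (coeff H) mH
  mulCoeff-leading {mG = a₀ , b₀ , c₀} {mH = a₁ , b₁ , c₁} (leading _ G-max) (leading _ H-max) =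
    trans (sum³-single (a₀ + a₁) (b₀ + b₁) (c₀ + c₁) _
             (ℕP.m≤m+n a₀ a₁) (ℕP.m≤m+n b₀ b₁) (ℕP.m≤m+n c₀ c₁) other-terms)
          (cong (λ e → coeff G a₀ b₀ c₀ ℚ.* at (coeff H) e) H-exponents)
    where
    H-exponents : (a₀ + a₁ ∸ a₀ , b₀ + b₁ ∸ b₀ , c₀ + c₁ ∸ c₀) ≡ (a₁ , b₁ , c₁)
    H-exponents = cong₂ _,_ (ℕP.m+n∸m≡n a₀ a₁) (cong₂ _,_ (ℕP.m+n∸m≡n b₀ b₁) (ℕP.m+n∸m≡n c₀ c₁))

    other-terms : ∀ a b c → a ≤ a₀ + a₁ → b ≤ b₀ + b₁ → c ≤ c₀ + c₁ → (a , b , c) ≢ (a₀ , b₀ , c₀) →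
      coeff G a b c ℚ.* coeff H (a₀ + a₁ ∸ a) (b₀ + b₁ ∸ b) (c₀ + c₁ ∸ c) ≡ 0ℚ
    other-terms a b c a≤ b≤ c≤ ≢mG = *-≡0 _ _ λ G≢0 H≢0 →
      ≢mG (key-injective w₁ w₂ (⊕-cancel-≤ (G-max _ G≢0) (H-max _ H≢0) (begin
        K (a , b , c) ⊕ K (a₀ + a₁ ∸ a , b₀ + b₁ ∸ b , c₀ + c₁ ∸ c)
          ≡⟨ sym (key-+ᵐ w₁ w₂ (a , b , c) _) ⟩
        K ((a , b , c) +ᵐ (a₀ + a₁ ∸ a , b₀ + b₁ ∸ b , c₀ + c₁ ∸ c))
          ≡⟨ cong K (+ᵐ-∸ a≤ b≤ c≤) ⟩
        K ((a₀ , b₀ , c₀) +ᵐ (a₁ , b₁ , c₁))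
          ≡⟨ key-+ᵐ w₁ w₂ (a₀ , b₀ , c₀) (a₁ , b₁ , c₁) ⟩
        K (a₀ , b₀ , c₀) ⊕ K (a₁ , b₁ , c₁) ∎)))
      where open ≡-Reasoning

  leading-product : ∀ {F mG mH} → IsProduct F G H →
    Leading w₁ w₂ (coeff G) mG → Leading w₁ w₂ (coeff H) mH → Leading w₁ w₂ (coeff F) (mG +ᵐ mH)
  leading-product {F} {mG} {mH} F≡GH G-lead H-lead = leading F∋mG+mH F-max
    where
    F∋mG+mH : InSupport (coeff F) (mG +ᵐ mH)
    F∋mG+mH F≡0 = *-≢0 _ _ (in-support G-lead) (in-support H-lead)
      (trans (sym (mulCoeff-leading G-lead H-lead)) (trans (sym (F≡GH-at (mG +ᵐ mH))) F≡0))
      where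
      F≡GH-at : ∀ e → at (coeff F) e ≡ at (mulCoeff G H) e
      F≡GH-at (i , j , k) = F≡GH i j k
    F-max : ∀ e → InSupport (coeff F) e → K e ≤ₗ K (mG +ᵐ mH)
    F-max (i , j , k) e∈ = subst (K (i , j , k) ≤ₗ_) (sym (key-+ᵐ w₁ w₂ mG mH))
      (mulCoeff-below G-lead H-lead i j k (λ GH≡0 → e∈ (trans (F≡GH i j k) GH≡0)))

Homogeneous : ℕ → Coef → Set
Homogeneous d C = ∀ e → InSupport C e → deg e ≡ d

degree-weight co-degree-weight zero-weight : Weight
degree-weight    = (+ 1 , + 1 , + 1)
co-degree-weight = (ℤ.- + 1 , ℤ.- + 1 , ℤ.- + 1)
zero-weight      = (+ 0 , + 0 , + 0)

⟨degree⟩ : ∀ e → ⟨ degree-weight , e ⟩ ≡ + deg e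
⟨degree⟩ (a , b , c) = trans (⟨⟩-ℕ 1 1 1 (a , b , c))
  (cong +_ (cong₂ _+_ (cong₂ _+_ (ℕP.*-identityˡ a) (ℕP.*-identityˡ b)) (ℕP.*-identityˡ c)))

⟨co-degree⟩ : ∀ e → ⟨ co-degree-weight , e ⟩ ≡ ℤ.- + deg e
⟨co-degree⟩ (a , b , c) = begin
  ℤ.-1ℤ ℤ.* + a ℤ.+ ℤ.-1ℤ ℤ.* + b ℤ.+ ℤ.-1ℤ ℤ.* + c
    ≡⟨ solve 3 (λ a b c → :- con ℤ.1ℤ :* a :+ :- con ℤ.1ℤ :* b :+ :- con ℤ.1ℤ :* c := :- (a :+ b :+ c))
         refl (+ a) (+ b) (+ c) ⟩
  ℤ.- (+ a ℤ.+ + b ℤ.+ + c)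
    ≡⟨ cong ℤ.-_ (sym (trans (ℤP.pos-+ (a + b) c) (cong (ℤ._+ + c) (ℤP.pos-+ a b)))) ⟩
  ℤ.- + (a + b + c) ∎
  where
  open ≡-Reasoning
  open ZSolver

leading-max-deg : ∀ {C m e} → Leading degree-weight zero-weight C m → InSupport C e → deg e ≤ deg m
leading-max-deg {m = m} {e} (leading _ max) e∈ =
  ℤP.drop‿+≤+ (subst₂ ℤ._≤_ (⟨degree⟩ e) (⟨degree⟩ m) (head-mono-≤ (max e e∈)))

leading-min-deg : ∀ {C m e} → Leading co-degree-weight zero-weight C m → InSupport C e → deg m ≤ deg e
leading-min-deg {m = m} {e} (leading _ max) e∈ =
  ℤP.drop‿+≤+ (ℤP.neg-cancel-≤ (subst₂ ℤ._≤_ (⟨co-degree⟩ e) (⟨co-degree⟩ m) (head-mono-≤ (max e e∈))))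

+-squeeze : ∀ {a b X Y} → a ≤ X → b ≤ Y → a + b ≡ X + Y → a ≡ X × b ≡ Y
+-squeeze {a} {b} {X} {Y} a≤X b≤Y sum≡ = a≡X , ℕP.+-cancelˡ-≡ X b Y (subst (λ t → t + b ≡ X + Y) a≡X sum≡)
  where
  a≡X : a ≡ X
  a≡X = ℕP.≤-antisym a≤X
    (ℕP.+-cancelʳ-≤ b X a (ℕP.≤-trans (ℕP.+-monoʳ-≤ X b≤Y) (ℕP.≤-reflexive (sym sum≡))))

-- If F = G·H is homogeneous, so are G and H: the top-degree parts and the
-- bottom-degree parts of G and H multiply to those of F, which coincide.
factors-homogeneous : ∀ {d F G H eG eH} → IsProduct F G H → Homogeneous d (coeff F) →
  InSupport (coeff G) eG → InSupport (coeff H) eH →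
  (∃ λ dG → Homogeneous dG (coeff G)) × (∃ λ dH → Homogeneous dH (coeff H))
factors-homogeneous {d} {F} {G} {H} F≡GH F-hom G∋ H∋ =
  (deg mG⁺ , λ e e∈ → ℕP.≤-antisym (leading-max-deg G⁺ e∈)
                                   (subst (_≤ deg e) mG⁻≡mG⁺ (leading-min-deg G⁻ e∈))) ,
  (deg mH⁺ , λ e e∈ → ℕP.≤-antisym (leading-max-deg H⁺ e∈)
                                   (subst (_≤ deg e) mH⁻≡mH⁺ (leading-min-deg H⁻ e∈)))
  where
  mG⁺ mH⁺ mG⁻ mH⁻ : Mon
  mG⁺ = proj₁ (leading-exists degree-weight zero-weight G G∋)
  mH⁺ = proj₁ (leading-exists degree-weight zero-weight H H∋)
  mG⁻ = proj₁ (leading-exists co-degree-weight zero-weight G G∋)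
  mH⁻ = proj₁ (leading-exists co-degree-weight zero-weight H H∋)

  G⁺ : Leading degree-weight zero-weight (coeff G) mG⁺
  G⁺ = proj₂ (leading-exists degree-weight zero-weight G G∋)
  H⁺ : Leading degree-weight zero-weight (coeff H) mH⁺
  H⁺ = proj₂ (leading-exists degree-weight zero-weight H H∋)
  G⁻ : Leading co-degree-weight zero-weight (coeff G) mG⁻
  G⁻ = proj₂ (leading-exists co-degree-weight zero-weight G G∋)
  H⁻ : Leading co-degree-weight zero-weight (coeff H) mH⁻
  H⁻ = proj₂ (leading-exists co-degree-weight zero-weight H H∋)

  deg-sum : ∀ {w mG mH} → Leading w zero-weight (coeff G) mG → Leading w zero-weight (coeff H) mH →
    deg mG + deg mH ≡ d
  deg-sum {w} {mG} {mH} G-lead H-lead =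
    trans (sym (deg-+ᵐ mG mH)) (F-hom (mG +ᵐ mH) (in-support (leading-product {w} {zero-weight} {G} {H} {F} F≡GH G-lead H-lead)))

  squeezed : deg mG⁻ ≡ deg mG⁺ × deg mH⁻ ≡ deg mH⁺
  squeezed = +-squeeze (leading-max-deg G⁺ (in-support G⁻)) (leading-max-deg H⁺ (in-support H⁻))
                       (trans (deg-sum {co-degree-weight} G⁻ H⁻) (sym (deg-sum {degree-weight} G⁺ H⁺)))

  mG⁻≡mG⁺ : deg mG⁻ ≡ deg mG⁺
  mG⁻≡mG⁺ = proj₁ squeezed
  mH⁻≡mH⁺ : deg mH⁻ ≡ deg mH⁺
  mH⁻≡mH⁺ = proj₂ squeezed

infixl 6 _⊞_
infixl 7 _⊡_

_⊞_ : Coef → Coef → Coef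
(C ⊞ D) a b c = C a b c ℚ.+ D a b c

_⊡_ : ℚ → Coef → Coef
(q ⊡ C) a b c = q ℚ.* C a b c

timesX timesY timesZ : Coef → Coef
timesX C zero    b c = 0ℚ
timesX C (suc a) b c = C a b c
timesY C a zero    c = 0ℚ
timesY C a (suc b) c = C a b c
timesZ C a b zero    = 0ℚ
timesZ C a b (suc c) = C a b c

linear-times : ℚ → ℚ → ℚ → Coef → Coef
linear-times α β γ C = α ⊡ timesX C ⊞ β ⊡ timesY C ⊞ γ ⊡ timesZ C

one : Coef
one zero zero zero = 1ℚ
one _    _    _    = 0ℚ

one-support : ∀ a b c → one a b c ≢ 0ℚ → a ≡ 0 × b ≡ 0 × c ≡ 0
one-support zero    zero    zero    _   = refl , refl , refl
one-support zero    zero    (suc c) 1≢0 = ⊥-elim (1≢0 refl)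
one-support zero    (suc b) c       1≢0 = ⊥-elim (1≢0 refl)
one-support (suc a) b       c       1≢0 = ⊥-elim (1≢0 refl)

⊞-support : ∀ C D a b c → (C ⊞ D) a b c ≢ 0ℚ → C a b c ≢ 0ℚ ⊎ D a b c ≢ 0ℚ
⊞-support C D a b c C+D≢0 with C a b c ℚP.≟ 0ℚ | D a b c ℚP.≟ 0ℚ
... | no C≢0   | _        = inj₁ C≢0
... | yes _    | no D≢0   = inj₂ D≢0
... | yes C≡0  | yes D≡0  = ⊥-elim (C+D≢0 (cong₂ ℚ._+_ C≡0 D≡0))

⊡-support : ∀ q C a b c → (q ⊡ C) a b c ≢ 0ℚ → q ≢ 0ℚ × C a b c ≢ 0ℚ
⊡-support q C a b c qC≢0 = *-≢0ˡ q (C a b c) qC≢0 , *-≢0ʳ q (C a b c) qC≢0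

timesX-support : ∀ C a b c → timesX C a b c ≢ 0ℚ → ∃ λ a′ → a ≡ suc a′ × C a′ b c ≢ 0ℚ
timesX-support C zero    b c 0≢0 = ⊥-elim (0≢0 refl)
timesX-support C (suc a) b c C≢0 = a , refl , C≢0

timesY-support : ∀ C a b c → timesY C a b c ≢ 0ℚ → ∃ λ b′ → b ≡ suc b′ × C a b′ c ≢ 0ℚ
timesY-support C a zero    c 0≢0 = ⊥-elim (0≢0 refl)
timesY-support C a (suc b) c C≢0 = b , refl , C≢0

timesZ-support : ∀ C a b c → timesZ C a b c ≢ 0ℚ → ∃ λ c′ → c ≡ suc c′ × C a b c′ ≢ 0ℚ
timesZ-support C a b zero    0≢0 = ⊥-elim (0≢0 refl)
timesZ-support C a b (suc c) C≢0 = c , refl , C≢0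

linear-times-support : ∀ α β γ C a b c → linear-times α β γ C a b c ≢ 0ℚ →
  (α ≢ 0ℚ × ∃ λ a′ → a ≡ suc a′ × C a′ b c ≢ 0ℚ) ⊎
  (β ≢ 0ℚ × ∃ λ b′ → b ≡ suc b′ × C a b′ c ≢ 0ℚ) ⊎
  (γ ≢ 0ℚ × ∃ λ c′ → c ≡ suc c′ × C a b c′ ≢ 0ℚ)
linear-times-support α β γ C a b c lC≢0
  with ⊞-support (α ⊡ timesX C ⊞ β ⊡ timesY C) (γ ⊡ timesZ C) a b c lC≢0
... | inj₂ z-part = inj₂ (inj₂ (map₂ (timesZ-support C a b c) (⊡-support γ (timesZ C) a b c z-part)))
... | inj₁ xy-part with ⊞-support (α ⊡ timesX C) (β ⊡ timesY C) a b c xy-part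
...   | inj₁ x-part = inj₁ (map₂ (timesX-support C a b c) (⊡-support α (timesX C) a b c x-part))
...   | inj₂ y-part = inj₂ (inj₁ (map₂ (timesY-support C a b c) (⊡-support β (timesY C) a b c y-part)))

κ : ℕ → ℚ
κ k = toℚ (+ suc k)

-κ≢0 : ∀ k → ℚ.- κ k ≢ 0ℚ
-κ≢0 k -κ≡0 = ℚP.<-irrefl (sym κ≡0) (ℚP.positive⁻¹ (κ k) {{ℚP.normalize-pos (suc k) 1}})
  where
  κ≡0 : κ k ≡ 0ℚ
  κ≡0 = ℚP.neg-injective -κ≡0

prodX prodY : ℕ → Coef
prodX zero    = one
prodX (suc k) = linear-times 1ℚ 0ℚ (ℚ.- κ k) (prodX k)
prodY zero    = one
prodY (suc k) = linear-times 0ℚ 1ℚ (ℚ.- κ k) (prodY k)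

curveCoef : ℕ → Coef
curveCoef n = timesY (prodX n) ⊞ timesZ (prodY n)

prodX-support : ∀ k a b c → prodX k a b c ≢ 0ℚ → b ≡ 0 × a + c ≡ k
prodX-support zero a b c 1≢0 with one-support a b c 1≢0
... | refl , refl , refl = refl , refl
prodX-support (suc k) a b c ≢0 with linear-times-support 1ℚ 0ℚ (ℚ.- κ k) (prodX k) a b c ≢0
... | inj₁ (_ , a′ , refl , ≢0′) = map₂ (cong suc) (prodX-support k a′ b c ≢0′)
... | inj₂ (inj₁ (0≢0 , _)) = ⊥-elim (0≢0 refl)
... | inj₂ (inj₂ (_ , c′ , refl , ≢0′)) =
  map₂ (λ a+c′≡k → trans (ℕP.+-suc a c′) (cong suc a+c′≡k)) (prodX-support k a b c′ ≢0′)

prodX-leading : ∀ k → prodX k k 0 0 ≡ 1ℚ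
prodX-leading zero    = refl
prodX-leading (suc k) rewrite prodX-leading k =
  solve 1 (λ q → con 1ℚ :* con 1ℚ :+ con 0ℚ :* con 0ℚ :+ q :* con 0ℚ := con 1ℚ) refl (ℚ.- κ k)
  where open QSolver

prodY-support : ∀ k a b c → prodY k a b c ≢ 0ℚ → a ≡ 0 × b + c ≡ k
prodY-support zero a b c 1≢0 with one-support a b c 1≢0
... | refl , refl , refl = refl , refl
prodY-support (suc k) a b c ≢0 with linear-times-support 0ℚ 1ℚ (ℚ.- κ k) (prodY k) a b c ≢0
... | inj₁ (0≢0 , _) = ⊥-elim (0≢0 refl)
... | inj₂ (inj₁ (_ , b′ , refl , ≢0′)) = map₂ (cong suc) (prodY-support k a b′ c ≢0′)
... | inj₂ (inj₂ (_ , c′ , refl , ≢0′)) =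
  map₂ (λ b+c′≡k → trans (ℕP.+-suc b c′) (cong suc b+c′≡k)) (prodY-support k a b c′ ≢0′)

prodY-leading : ∀ k → prodY k 0 0 k ≢ 0ℚ
prodY-leading zero    ()
prodY-leading (suc k) ≡0 = *-≢0 (ℚ.- κ k) (prodY k 0 0 k) (-κ≢0 k) (prodY-leading k) (trans (sym unfold) ≡0)
  where
  open QSolver
  unfold : prodY (suc k) 0 0 (suc k) ≡ ℚ.- κ k ℚ.* prodY k 0 0 k
  unfold = solve 2 (λ q p → con 0ℚ :* con 0ℚ :+ con 1ℚ :* con 0ℚ :+ q :* p := q :* p) refl (ℚ.- κ k) (prodY k 0 0 k)

curve-support : ∀ n a b c → curveCoef n a b c ≢ 0ℚ →
  (b ≡ 1 × a + c ≡ n) ⊎ (a ≡ 0 × 1 ≤ c × b + c ≡ suc n)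
curve-support n a b c ≢0 with ⊞-support (timesY (prodX n)) (timesZ (prodY n)) a b c ≢0
... | inj₁ y-part with timesY-support (prodX n) a b c y-part
...   | b′ , refl , ≢0′ with prodX-support n a b′ c ≢0′
...     | refl , a+c≡n = inj₁ (refl , a+c≡n)
curve-support n a b c ≢0 | inj₂ z-part with timesZ-support (prodY n) a b c z-part
...   | c′ , refl , ≢0′ with prodY-support n a b c′ ≢0′
...     | refl , b+c′≡n = inj₂ (refl , s≤s z≤n , trans (ℕP.+-suc b c′) (cong suc b+c′≡n))

curve-homogeneous : ∀ n → Homogeneous (suc n) (curveCoef n)
curve-homogeneous n (a , b , c) ≢0 with curve-support n a b c ≢0
... | inj₁ (refl , a+c≡n) = trans (ℕP.+-assoc a 1 c) (trans (ℕP.+-suc a c) (cong suc a+c≡n))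
... | inj₂ (refl , _ , b+c≡) = b+c≡

x₀ⁿx₁∈curve : ∀ n → curveCoef n n 1 0 ≢ 0ℚ
x₀ⁿx₁∈curve n ≡0 rewrite prodX-leading n = ℚP.1≢0 ≡0

x₂ⁿ⁺¹∈curve : ∀ n → curveCoef n 0 0 (suc n) ≢ 0ℚ
x₂ⁿ⁺¹∈curve n ≡0 = prodY-leading n (trans (sym (ℚP.+-identityˡ (prodY n 0 0 n))) ≡0)

exponents-≤-deg : ∀ a b c → a ≤ a + b + c × b ≤ a + b + c × c ≤ a + b + c
exponents-≤-deg a b c =
  ℕP.≤-trans (ℕP.m≤m+n a b) (ℕP.m≤m+n (a + b) c) ,
  ℕP.≤-trans (ℕP.m≤n+m b a) (ℕP.m≤m+n (a + b) c) ,
  ℕP.m≤n+m c (a + b)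

curve : ℕ → Poly
curve n = record { coeff = curveCoef n ; bound = suc n ; support = exponents-≤-bound }
  where
  exponents-≤-bound : ∀ a b c → curveCoef n a b c ≢ 0ℚ → a ≤ suc n × b ≤ suc n × c ≤ suc n
  exponents-≤-bound a b c ≢0 rewrite sym (curve-homogeneous n (a , b , c) ≢0) = exponents-≤-deg a b c

-- The Newton polygon of Fₙ has the edge [x₀ⁿx₁, x₂ⁿ⁺¹], cut out by the
-- weight (n+1, 0, n), and this edge contains no other lattice point.  In
-- a factorisation Fₙ = G·H the two ends of the edge split as sums of the
-- corresponding leading monomials of G and H; homogeneity of G and H then
-- forces one of them to have degree 0.

y-weight z-weight : Weight
y-weight = (+ 0 , + 1 , + 0)
z-weight = (+ 0 , + 0 , + 1)

key-by-first : ∀ w₁ w₂ e e′ → ⟨ w₁ , e ⟩ ℤ.< ⟨ w₁ , e′ ⟩ → key w₁ w₂ e ≤ₗ key w₁ w₂ e′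
key-by-first w₁ w₂ (a , b , c) (a′ , b′ , c′) lt = inj₁ (here lt)

key-by-second : ∀ w₁ w₂ e e′ → ⟨ w₁ , e ⟩ ≡ ⟨ w₁ , e′ ⟩ → ⟨ w₂ , e ⟩ ℤ.< ⟨ w₂ , e′ ⟩ →
  key w₁ w₂ e ≤ₗ key w₁ w₂ e′
key-by-second w₁ w₂ (a , b , c) (a′ , b′ , c′) eq lt rewrite eq = inj₁ (there (here lt))

-- The lattice segment from (n, 1, 0) to (0, 0, n+1) is primitive: if it is
-- split as mG + mH with mG = (α, β, 0) of the same degree and weight as a
-- multiple (0, 0, α + β) of the endpoint (0, 0, 1), then mG or mH is 0.
edge-primitive : ∀ n α β α′ β′ → α + α′ ≡ n → β + β′ ≡ 1 → suc n * α ≡ n * (α + β) →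
  α + β ≡ 0 ⊎ α′ + β′ ≡ 0
edge-primitive n α β α′ β′ α+α′≡n β+β′≡1 weight≡ = cases β β′ β+β′≡1 α≡nβ
  where
  α≡nβ : α ≡ n * β
  α≡nβ = ℕP.+-cancelˡ-≡ (n * α) α (n * β) (begin
    n * α + α      ≡⟨ ℕP.+-comm (n * α) α ⟩
    suc n * α      ≡⟨ weight≡ ⟩
    n * (α + β)    ≡⟨ ℕP.*-distribˡ-+ n α β ⟩
    n * α + n * β  ∎)
    where open ≡-Reasoning

  cases : ∀ β β′ → β + β′ ≡ 1 → α ≡ n * β → α + β ≡ 0 ⊎ α′ + β′ ≡ 0
  cases zero _ _ α≡n*0 = inj₁ (trans (ℕP.+-identityʳ α) (trans α≡n*0 (ℕP.*-zeroʳ n)))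
  cases (suc zero) zero _ α≡n*1 = inj₂ (trans (ℕP.+-identityʳ α′) α′≡0)
    where
    α′≡0 : α′ ≡ 0
    α′≡0 = ℕP.+-cancelˡ-≡ n α′ 0 (begin
      n + α′  ≡⟨ cong (_+ α′) (sym (trans α≡n*1 (ℕP.*-identityʳ n))) ⟩
      α + α′  ≡⟨ α+α′≡n ⟩
      n       ≡⟨ ℕP.+-identityʳ n ⟨
      n + 0   ∎)
      where open ≡-Reasoning
  cases (suc zero)    (suc _) ()
  cases (suc (suc _)) _       ()

module _ (n : ℕ) where

  e₁ e₂ : Mon
  e₁ = (n , 1 , 0)
  e₂ = (0 , 0 , suc n)

  edge-weight : Weight
  edge-weight = (+ suc n , + 0 , + n)

  edge-value : Mon → ℕ
  edge-value (a , b , c) = suc n * a + 0 * b + n * c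

  ⟨edge⟩ : ∀ e → ⟨ edge-weight , e ⟩ ≡ + edge-value e
  ⟨edge⟩ = ⟨⟩-ℕ (suc n) 0 n

  edge-ends : edge-value e₂ ≡ edge-value e₁
  edge-ends = solve 1 (λ n → (con 1 :+ n) :* con 0 :+ con 0 :+ n :* (con 1 :+ n)
                          := (con 1 :+ n) :* n :+ con 0 :+ n :* con 0) refl n
    where open NSolver

  -- Every monomial of Fₙ other than e₁, e₂ lies strictly below the edge: the
  -- monomials x₀ᵃ x₁ x₂ᶜ have value n² + a, the monomials x₁ᵇ x₂ᶜ value n c.
  below-edge : ∀ e → InSupport (curveCoef n) e → e ≡ e₁ ⊎ e ≡ e₂ ⊎ edge-value e < edge-value e₁
  below-edge (a , b , c) ≢0 with curve-support n a b c ≢0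
  below-edge (a , .1 , zero) ≢0 | inj₁ (refl , a+0≡n) =
    inj₁ (cong (λ a → (a , 1 , 0)) (trans (sym (ℕP.+-identityʳ a)) a+0≡n))
  below-edge (a , .1 , suc c) ≢0 | inj₁ (refl , a+c≡n) =
    inj₂ (inj₂ (subst (edge-value (a , 1 , suc c) <_) on-row (ℕP.m<m+n _ (s≤s z≤n))))
    where
    open ≡-Reasoning
    open NSolver
    on-row : edge-value (a , 1 , suc c) + suc c ≡ edge-value e₁
    on-row = begin
      suc n * a + 0 * 1 + n * suc c + suc c
        ≡⟨ solve 3 (λ n a c → (con 1 :+ n) :* a :+ con 0 :* con 1 :+ n :* c :+ c := (con 1 :+ n) :* (a :+ c))
             refl n a (suc c) ⟩
      suc n * (a + suc c)
        ≡⟨ cong (suc n *_) a+c≡n ⟩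
      suc n * n
        ≡⟨ solve 1 (λ n → (con 1 :+ n) :* n := (con 1 :+ n) :* n :+ con 0 :* con 1 :+ n :* con 0) refl n ⟩
      edge-value e₁ ∎
  below-edge (.0 , zero , c) ≢0 | inj₂ (refl , _ , c≡1+n) = inj₂ (inj₁ (cong (λ c → (0 , 0 , c)) c≡1+n))
  below-edge (.0 , suc b , c) ≢0 | inj₂ (refl , 1≤c , b+c≡) = inj₂ (inj₂ (begin-strict
      edge-value (0 , suc b , c)
        ≡⟨ solve 3 (λ n b c → (con 1 :+ n) :* con 0 :+ con 0 :* b :+ n :* c := n :* c) refl n (suc b) c ⟩
      n * c      ≤⟨ ℕP.*-monoʳ-≤ n c≤n ⟩
      n * n      <⟨ ℕP.m<m+n (n * n) (ℕP.<-≤-trans 1≤c c≤n) ⟩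
      n * n + n
        ≡⟨ solve 1 (λ n → n :* n :+ n := (con 1 :+ n) :* n :+ con 0 :* con 1 :+ n :* con 0) refl n ⟩
      edge-value e₁ ∎))
    where
    open ℕP.≤-Reasoning
    open NSolver
    c≤n : c ≤ n
    c≤n = ℕP.≤-pred (subst (c <_) b+c≡ (ℕP.m<n+m c (s≤s z≤n)))

  curve-leading₁ : Leading edge-weight y-weight (curveCoef n) e₁
  curve-leading₁ = leading (x₀ⁿx₁∈curve n) below
    where
    below : ∀ e → InSupport (curveCoef n) e → key edge-weight y-weight e ≤ₗ key edge-weight y-weight e₁
    below e ≢0 with below-edge e ≢0
    ... | inj₁ refl        = inj₂ refl
    ... | inj₂ (inj₁ refl) = key-by-second edge-weight y-weight e₂ e₁
                               (trans (⟨edge⟩ e₂) (trans (cong +_ edge-ends) (sym (⟨edge⟩ e₁))))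
                               (subst₂ ℤ._<_ (sym (⟨⟩-ℕ 0 1 0 e₂)) (sym (⟨⟩-ℕ 0 1 0 e₁)) (ℤ.+<+ (s≤s z≤n)))
    ... | inj₂ (inj₂ lt)   = key-by-first edge-weight y-weight e e₁
                               (subst₂ ℤ._<_ (sym (⟨edge⟩ e)) (sym (⟨edge⟩ e₁)) (ℤ.+<+ lt))

  curve-leading₂ : Leading edge-weight z-weight (curveCoef n) e₂
  curve-leading₂ = leading (x₂ⁿ⁺¹∈curve n) below
    where
    below : ∀ e → InSupport (curveCoef n) e → key edge-weight z-weight e ≤ₗ key edge-weight z-weight e₂
    below e ≢0 with below-edge e ≢0
    ... | inj₂ (inj₁ refl) = inj₂ refl
    ... | inj₁ refl        = key-by-second edge-weight z-weight e₁ e₂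
                               (trans (⟨edge⟩ e₁) (trans (cong +_ (sym edge-ends)) (sym (⟨edge⟩ e₂))))
                               (subst₂ ℤ._<_ (sym (⟨⟩-ℕ 0 0 1 e₁)) (sym (⟨⟩-ℕ 0 0 1 e₂))
                                 (ℤ.+<+ (subst (0 <_) (sym (ℕP.+-identityʳ (suc n))) (s≤s z≤n))))
    ... | inj₂ (inj₂ lt)   = key-by-first edge-weight z-weight e e₂
                               (subst₂ ℤ._<_ (sym (⟨edge⟩ e)) (sym (⟨edge⟩ e₂))
                                 (ℤ.+<+ (subst (edge-value e <_) (sym edge-ends) lt)))

  edge-split : ∀ mG mH mG′ mH′ → mG +ᵐ mH ≡ e₁ → mG′ +ᵐ mH′ ≡ e₂ →
    edge-value mG ≡ edge-value mG′ → deg mG ≡ deg mG′ → deg mG ≡ 0 ⊎ deg mH ≡ 0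
  edge-split (α , β , γ) (α′ , β′ , γ′) (x , y , z) _ split₁ split₂ value≡ deg≡
    with ℕP.m+n≡0⇒m≡0 γ (cong (proj₂ ∘ proj₂) split₁) | ℕP.m+n≡0⇒n≡0 γ (cong (proj₂ ∘ proj₂) split₁)
       | ℕP.m+n≡0⇒m≡0 x (cong proj₁ split₂) | ℕP.m+n≡0⇒m≡0 y (cong (proj₁ ∘ proj₂) split₂)
  ... | refl | refl | refl | refl =
    Sum.map (trans (ℕP.+-identityʳ (α + β))) (trans (ℕP.+-identityʳ (α′ + β′)))
      (edge-primitive n α β α′ β′ (cong proj₁ split₁) (cong (proj₁ ∘ proj₂) split₁) weight≡)
    where
    open ≡-Reasoning
    open NSolver
    weight≡ : suc n * α ≡ n * (α + β)
    weight≡ = begin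
      suc n * α
        ≡⟨ solve 3 (λ n α β → (con 1 :+ n) :* α := (con 1 :+ n) :* α :+ con 0 :* β :+ n :* con 0) refl n α β ⟩
      edge-value (α , β , 0)  ≡⟨ value≡ ⟩
      edge-value (0 , 0 , z)
        ≡⟨ solve 2 (λ n z → (con 1 :+ n) :* con 0 :+ con 0 :* con 0 :+ n :* z := n :* z) refl n z ⟩
      n * z                   ≡⟨ cong (n *_) (trans (sym deg≡) (ℕP.+-identityʳ (α + β))) ⟩
      n * (α + β)             ∎

  constant-factor : ∀ {G H eG eH} → IsProduct (curve n) G H →
    InSupport (coeff G) eG → InSupport (coeff H) eH → Homogeneous 0 (coeff G) ⊎ Homogeneous 0 (coeff H)
  constant-factor {G} {H} {eG} {eH} F≡GH G∋ H∋ =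
    Sum.map (λ deg≡0 → subst (λ d → Homogeneous d (coeff G)) (trans (sym (G-hom m₁G (in-support G₁))) deg≡0) G-hom)
            (λ deg≡0 → subst (λ d → Homogeneous d (coeff H)) (trans (sym (H-hom m₁H (in-support H₁))) deg≡0) H-hom)
            (edge-split m₁G m₁H m₂G m₂H split₁ split₂ same-face same-degree)
    where
    factor-degrees : (∃ λ dG → Homogeneous dG (coeff G)) × (∃ λ dH → Homogeneous dH (coeff H))
    factor-degrees = factors-homogeneous {F = curve n} {G} {H} {eG} {eH} F≡GH (curve-homogeneous n) G∋ H∋

    G-hom : Homogeneous (proj₁ (proj₁ factor-degrees)) (coeff G)
    G-hom = proj₂ (proj₁ factor-degrees)
    H-hom : Homogeneous (proj₁ (proj₂ factor-degrees)) (coeff H)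
    H-hom = proj₂ (proj₂ factor-degrees)

    m₁G m₁H m₂G m₂H : Mon
    m₁G = proj₁ (leading-exists edge-weight y-weight G G∋)
    m₁H = proj₁ (leading-exists edge-weight y-weight H H∋)
    m₂G = proj₁ (leading-exists edge-weight z-weight G G∋)
    m₂H = proj₁ (leading-exists edge-weight z-weight H H∋)

    G₁ : Leading edge-weight y-weight (coeff G) m₁G
    G₁ = proj₂ (leading-exists edge-weight y-weight G G∋)
    H₁ : Leading edge-weight y-weight (coeff H) m₁H
    H₁ = proj₂ (leading-exists edge-weight y-weight H H∋)
    G₂ : Leading edge-weight z-weight (coeff G) m₂G
    G₂ = proj₂ (leading-exists edge-weight z-weight G G∋)
    H₂ : Leading edge-weight z-weight (coeff H) m₂H
    H₂ = proj₂ (leading-exists edge-weight z-weight H H∋)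

    split₁ : m₁G +ᵐ m₁H ≡ e₁
    split₁ = leading-unique (leading-product {edge-weight} {y-weight} {G} {H} {curve n} F≡GH G₁ H₁) curve-leading₁
    split₂ : m₂G +ᵐ m₂H ≡ e₂
    split₂ = leading-unique (leading-product {edge-weight} {z-weight} {G} {H} {curve n} F≡GH G₂ H₂) curve-leading₂

    same-face : edge-value m₁G ≡ edge-value m₂G
    same-face = ℤP.+-injective
      (subst₂ _≡_ (⟨edge⟩ m₁G) (⟨edge⟩ m₂G) (leading-same-face {edge-weight} {y-weight} {z-weight} G₁ G₂))

    same-degree : deg m₁G ≡ deg m₂G
    same-degree = trans (G-hom m₁G (in-support G₁)) (sym (G-hom m₂G (in-support G₂)))

  curve-irreducible : Irreducible (curve n)
  curve-irreducible = (n , 1 , 0 , 0<deg , x₀ⁿx₁∈curve n) , no-factorisation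
    where
    0<deg : 0 < n + 1 + 0
    0<deg = subst (0 <_) (sym (curve-homogeneous n e₁ (x₀ⁿx₁∈curve n))) (s≤s z≤n)

    no-factorisation : ∀ G H → IsProduct (curve n) G H → ¬ (NonConstant G × NonConstant H)
    no-factorisation G H F≡GH ((i , j , k , 0<degG , G∋) , (i′ , j′ , k′ , 0<degH , H∋)) =
      Sum.[ (λ G-const → ℕP.<⇒≢ 0<degG (sym (G-const (i , j , k) G∋)))
          , (λ H-const → ℕP.<⇒≢ 0<degH (sym (H-const (i′ , j′ , k′) H∋))) ]
        (constant-factor {G} {H} {i , j , k} {i′ , j′ , k′} F≡GH G∋ H∋)

-- The value at (x, y, z) of C, summing over exponents ≤ M; by definition
-- eval F x y z = Ev (bound F) (coeff F) x y z on integer points.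
Ev : ℕ → Coef → ℚ → ℚ → ℚ → ℚ
Ev M C x y z = sumℚ M λ i → sumℚ M λ j → sumℚ M λ k → C i j k ℚ.* (powℚ x i ℚ.* (powℚ y j ℚ.* powℚ z k))

Ev-⊞ : ∀ M C D x y z → Ev M (C ⊞ D) x y z ≡ Ev M C x y z ℚ.+ Ev M D x y z
Ev-⊞ M C D x y z =
  trans (sum-cong M λ i _ → trans (sum-cong M λ j _ →
           trans (sum-cong M λ k _ → ℚP.*-distribʳ-+ _ (C i j k) (D i j k)) (sum-+ M _ _))
         (sum-+ M _ _))
        (sum-+ M _ _)

Ev-⊡ : ∀ M q C x y z → Ev M (q ⊡ C) x y z ≡ q ℚ.* Ev M C x y z
Ev-⊡ M q C x y z =
  trans (sum-cong M λ i _ → trans (sum-cong M λ j _ →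
           trans (sum-cong M λ k _ → ℚP.*-assoc q (C i j k) _) (sum-scale M q _))
         (sum-scale M q _))
        (sum-scale M q _)

-- Multiplying by a variable shifts the summation index; the shift is
-- harmless when the top summand vanishes.
sum-shift : ∀ m (u t : ℕ → ℚ) x → u 0 ≡ 0ℚ → (∀ a → u (suc a) ≡ x ℚ.* t a) → t (suc m) ≡ 0ℚ →
  sumℚ (suc m) u ≡ x ℚ.* sumℚ (suc m) t
sum-shift m u t x u0≡0 u-shift top≡0 = begin
  sumℚ (suc m) u                ≡⟨ sum-unfoldˡ m u ⟩
  u 0 ℚ.+ sumℚ m (u ∘ suc)      ≡⟨ cong₂ ℚ._+_ u0≡0 (sum-cong m λ a _ → u-shift a) ⟩
  0ℚ ℚ.+ sumℚ m (λ a → x ℚ.* t a) ≡⟨ ℚP.+-identityˡ _ ⟩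
  sumℚ m (λ a → x ℚ.* t a)      ≡⟨ sum-scale m x t ⟩
  x ℚ.* sumℚ m t                ≡⟨ cong (x ℚ.*_) top-dropped ⟨
  x ℚ.* sumℚ (suc m) t          ∎
  where
  open ≡-Reasoning
  top-dropped : sumℚ (suc m) t ≡ sumℚ m t
  top-dropped = trans (cong (sumℚ m t ℚ.+_) top≡0) (ℚP.+-identityʳ (sumℚ m t))

DegreeAtMost : ℕ → Coef → Set
DegreeAtMost m C = ∀ a b c → C a b c ≢ 0ℚ → a + b + c ≤ m

vanish-above : ∀ {m C} → DegreeAtMost m C → ∀ a b c → m < a + b + c → C a b c ≡ 0ℚ
vanish-above {m} {C} deg≤m a b c m<deg with C a b c ℚP.≟ 0ℚ
... | yes C≡0 = C≡0
... | no C≢0  = ⊥-elim (ℕP.<-irrefl refl (ℕP.<-≤-trans m<deg (deg≤m a b c C≢0)))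

-- For C of degree ≤ m, the products xᵢ·C still have all exponents ≤ m + 1,
-- so evaluating with exponent bound m + 1 is multiplicative on them.
module _ (m : ℕ) (C : Coef) (x y z : ℚ) (deg≤m : DegreeAtMost m C) where

  private
    open QSolver
    zero-term : ∀ p → 0ℚ ℚ.* p ≡ 0ℚ
    zero-term = ℚP.*-zeroˡ
    top-term : ∀ {a b c} p → m < a + b + c → C a b c ℚ.* p ≡ 0ℚ
    top-term {a} {b} {c} p m<deg = trans (cong (ℚ._* p) (vanish-above deg≤m a b c m<deg)) (zero-term p)

  Ev-timesX : Ev (suc m) (timesX C) x y z ≡ x ℚ.* Ev (suc m) C x y z
  Ev-timesX = sum-shift m _ _ x
    (sum-zero (suc m) λ j _ → sum-zero (suc m) λ k _ → zero-term (powℚ x 0 ℚ.* (powℚ y j ℚ.* powℚ z k)))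
    (λ a → trans (sum-cong (suc m) λ j _ → trans (sum-cong (suc m) λ k _ → pull-x (C a j k) (powℚ x a) _)
                   (sum-scale (suc m) x _))
                 (sum-scale (suc m) x _))
    (sum-zero (suc m) λ j _ → sum-zero (suc m) λ k _ →
       top-term _ (s≤s (ℕP.≤-trans (ℕP.m≤m+n m j) (ℕP.m≤m+n (m + j) k))))
    where
    pull-x : ∀ c X Y → c ℚ.* ((x ℚ.* X) ℚ.* Y) ≡ x ℚ.* (c ℚ.* (X ℚ.* Y))
    pull-x = solve 4 (λ x c X Y → c :* ((x :* X) :* Y) := x :* (c :* (X :* Y))) refl x

  Ev-timesY : Ev (suc m) (timesY C) x y z ≡ y ℚ.* Ev (suc m) C x y z
  Ev-timesY = trans (sum-cong (suc m) λ i _ → sum-shift m _ _ y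
      (sum-zero (suc m) λ k _ → zero-term (powℚ x i ℚ.* (powℚ y 0 ℚ.* powℚ z k)))
      (λ b → trans (sum-cong (suc m) λ k _ → pull-y (C i b k) (powℚ x i) (powℚ y b) _) (sum-scale (suc m) y _))
      (sum-zero (suc m) λ k _ →
         top-term _ (ℕP.≤-trans (ℕP.m≤n+m (suc m) i) (ℕP.m≤m+n (i + suc m) k))))
    (sum-scale (suc m) y _)
    where
    pull-y : ∀ c X Y Z → c ℚ.* (X ℚ.* ((y ℚ.* Y) ℚ.* Z)) ≡ y ℚ.* (c ℚ.* (X ℚ.* (Y ℚ.* Z)))
    pull-y = solve 5 (λ y c X Y Z → c :* (X :* ((y :* Y) :* Z)) := y :* (c :* (X :* (Y :* Z)))) refl y

  Ev-timesZ : Ev (suc m) (timesZ C) x y z ≡ z ℚ.* Ev (suc m) C x y z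
  Ev-timesZ = trans (sum-cong (suc m) λ i _ → trans (sum-cong (suc m) λ j _ → sum-shift m _ _ z
      (zero-term (powℚ x i ℚ.* (powℚ y j ℚ.* powℚ z 0)))
      (λ c → pull-z (C i j c) (powℚ x i) (powℚ y j) (powℚ z c))
      (top-term _ (ℕP.≤-trans (s≤s (ℕP.m≤n+m m (i + j))) (ℕP.≤-reflexive (sym (ℕP.+-suc (i + j) m))))))
    (sum-scale (suc m) z _))
    (sum-scale (suc m) z _)
    where
    pull-z : ∀ c X Y Z → c ℚ.* (X ℚ.* (Y ℚ.* (z ℚ.* Z))) ≡ z ℚ.* (c ℚ.* (X ℚ.* (Y ℚ.* Z)))
    pull-z = solve 5 (λ z c X Y Z → c :* (X :* (Y :* (z :* Z))) := z :* (c :* (X :* (Y :* Z)))) refl z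

  Ev-linear-times : ∀ α β γ →
    Ev (suc m) (linear-times α β γ C) x y z ≡ (α ℚ.* x ℚ.+ β ℚ.* y ℚ.+ γ ℚ.* z) ℚ.* Ev (suc m) C x y z
  Ev-linear-times α β γ = begin
    Ev (suc m) (α ⊡ timesX C ⊞ β ⊡ timesY C ⊞ γ ⊡ timesZ C) x y z
      ≡⟨ Ev-⊞ (suc m) (α ⊡ timesX C ⊞ β ⊡ timesY C) (γ ⊡ timesZ C) x y z ⟩
    Ev (suc m) (α ⊡ timesX C ⊞ β ⊡ timesY C) x y z ℚ.+ Ev (suc m) (γ ⊡ timesZ C) x y z
      ≡⟨ cong (ℚ._+ Ev (suc m) (γ ⊡ timesZ C) x y z) (Ev-⊞ (suc m) (α ⊡ timesX C) (β ⊡ timesY C) x y z) ⟩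
    Ev (suc m) (α ⊡ timesX C) x y z ℚ.+ Ev (suc m) (β ⊡ timesY C) x y z ℚ.+ Ev (suc m) (γ ⊡ timesZ C) x y z
      ≡⟨ cong₂ ℚ._+_ (cong₂ ℚ._+_ (Ev-⊡ (suc m) α _ x y z) (Ev-⊡ (suc m) β _ x y z)) (Ev-⊡ (suc m) γ _ x y z) ⟩
    α ℚ.* Ev (suc m) (timesX C) x y z ℚ.+ β ℚ.* Ev (suc m) (timesY C) x y z ℚ.+ γ ℚ.* Ev (suc m) (timesZ C) x y z
      ≡⟨ cong₂ ℚ._+_ (cong₂ ℚ._+_ (cong (α ℚ.*_) Ev-timesX) (cong (β ℚ.*_) Ev-timesY)) (cong (γ ℚ.*_) Ev-timesZ) ⟩
    α ℚ.* (x ℚ.* E) ℚ.+ β ℚ.* (y ℚ.* E) ℚ.+ γ ℚ.* (z ℚ.* E)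
      ≡⟨ solve 7 (λ α β γ x y z E → α :* (x :* E) :+ β :* (y :* E) :+ γ :* (z :* E) := (α :* x :+ β :* y :+ γ :* z) :* E)
           refl α β γ x y z E ⟩
    (α ℚ.* x ℚ.+ β ℚ.* y ℚ.+ γ ℚ.* z) ℚ.* E ∎
    where
    open ≡-Reasoning
    E : ℚ
    E = Ev (suc m) C x y z

prodX-degree : ∀ {k m} → k ≤ m → DegreeAtMost m (prodX k)
prodX-degree {k} k≤m a b c ≢0 with prodX-support k a b c ≢0
... | refl , a+c≡k = ℕP.≤-trans (ℕP.≤-reflexive (trans (cong (_+ c) (ℕP.+-identityʳ a)) a+c≡k)) k≤m

prodY-degree : ∀ {k m} → k ≤ m → DegreeAtMost m (prodY k)
prodY-degree {k} k≤m a b c ≢0 with prodY-support k a b c ≢0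
... | refl , b+c≡k = ℕP.≤-trans (ℕP.≤-reflexive b+c≡k) k≤m

prodX-vanishes : ∀ n k → k ≤ n → ∀ i → i < k → ∀ y → Ev (suc n) (prodX k) (κ i) y 1ℚ ≡ 0ℚ
prodX-vanishes n (suc k) 1+k≤n i i<1+k y =
  trans (Ev-linear-times n (prodX k) (κ i) y 1ℚ (prodX-degree k≤n) 1ℚ 0ℚ (ℚ.- κ k))
        (vanishing (ℕP.m<1+n⇒m<n∨m≡n i<1+k))
  where
  k≤n : k ≤ n
  k≤n = ℕP.≤-trans (ℕP.n≤1+n k) 1+k≤n
  factor : ℚ
  factor = 1ℚ ℚ.* κ i ℚ.+ 0ℚ ℚ.* y ℚ.+ ℚ.- κ k ℚ.* 1ℚ
  E : ℚ
  E = Ev (suc n) (prodX k) (κ i) y 1ℚ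
  vanishing : i < k ⊎ i ≡ k → factor ℚ.* E ≡ 0ℚ
  vanishing (inj₁ i<k)  = trans (cong (factor ℚ.*_) (prodX-vanishes n k k≤n i i<k y)) (ℚP.*-zeroʳ factor)
  vanishing (inj₂ refl) = trans (cong (ℚ._* E) factor≡0) (ℚP.*-zeroˡ E)
    where
    open QSolver
    factor≡0 : factor ≡ 0ℚ
    factor≡0 = solve 2 (λ q y → con 1ℚ :* q :+ con 0ℚ :* y :+ :- q :* con 1ℚ := con 0ℚ) refl (κ i) y

prodY-vanishes : ∀ n k → k ≤ n → ∀ j → j < k → ∀ x → Ev (suc n) (prodY k) x (κ j) 1ℚ ≡ 0ℚ
prodY-vanishes n (suc k) 1+k≤n j j<1+k x =
  trans (Ev-linear-times n (prodY k) x (κ j) 1ℚ (prodY-degree k≤n) 0ℚ 1ℚ (ℚ.- κ k))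
        (vanishing (ℕP.m<1+n⇒m<n∨m≡n j<1+k))
  where
  k≤n : k ≤ n
  k≤n = ℕP.≤-trans (ℕP.n≤1+n k) 1+k≤n
  factor : ℚ
  factor = 0ℚ ℚ.* x ℚ.+ 1ℚ ℚ.* κ j ℚ.+ ℚ.- κ k ℚ.* 1ℚ
  E : ℚ
  E = Ev (suc n) (prodY k) x (κ j) 1ℚ
  vanishing : j < k ⊎ j ≡ k → factor ℚ.* E ≡ 0ℚ
  vanishing (inj₁ j<k)  = trans (cong (factor ℚ.*_) (prodY-vanishes n k k≤n j j<k x)) (ℚP.*-zeroʳ factor)
  vanishing (inj₂ refl) = trans (cong (ℚ._* E) factor≡0) (ℚP.*-zeroˡ E)
    where
    open QSolver
    factor≡0 : factor ≡ 0ℚ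
    factor≡0 = solve 2 (λ q x → con 0ℚ :* x :+ con 1ℚ :* q :+ :- q :* con 1ℚ := con 0ℚ) refl (κ j) x

curve-value : ∀ n x y z →
  Ev (suc n) (curveCoef n) x y z ≡ y ℚ.* Ev (suc n) (prodX n) x y z ℚ.+ z ℚ.* Ev (suc n) (prodY n) x y z
curve-value n x y z = trans (Ev-⊞ (suc n) (timesY (prodX n)) (timesZ (prodY n)) x y z)
  (cong₂ ℚ._+_ (Ev-timesY n (prodX n) x y z (prodX-degree ℕP.≤-refl))
               (Ev-timesZ n (prodY n) x y z (prodY-degree ℕP.≤-refl)))

grid-point-on-curve : ∀ n a b → a < n → b < n → eval (curve n) (+ suc a) (+ suc b) (+ 1) ≡ 0ℚ
grid-point-on-curve n a b a<n b<n = begin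
  Ev (suc n) (curveCoef n) (κ a) (κ b) 1ℚ
    ≡⟨ curve-value n (κ a) (κ b) 1ℚ ⟩
  κ b ℚ.* Ev (suc n) (prodX n) (κ a) (κ b) 1ℚ ℚ.+ 1ℚ ℚ.* Ev (suc n) (prodY n) (κ a) (κ b) 1ℚ
    ≡⟨ cong₂ (λ u v → κ b ℚ.* u ℚ.+ 1ℚ ℚ.* v)
             (prodX-vanishes n n ℕP.≤-refl a a<n (κ b)) (prodY-vanishes n n ℕP.≤-refl b b<n (κ a)) ⟩
  κ b ℚ.* 0ℚ ℚ.+ 1ℚ ℚ.* 0ℚ
    ≡⟨ cong (ℚ._+ 0ℚ) (ℚP.*-zeroʳ (κ b)) ⟩
  0ℚ ∎
  where open ≡-Reasoning

corner-on-curve : ∀ n → eval (curve n) (+ 1) (+ 0) (+ 0) ≡ 0ℚ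
corner-on-curve n = trans (curve-value n 1ℚ 0ℚ 0ℚ)
  (cong₂ ℚ._+_ (ℚP.*-zeroˡ (Ev (suc n) (prodX n) 1ℚ 0ℚ 0ℚ)) (ℚP.*-zeroˡ (Ev (suc n) (prodY n) 1ℚ 0ℚ 0ℚ)))

module _ {A : Set} where

  remove : ∀ {y : A} (xs : List A) → y ∈ xs → List A
  remove (_ ∷ xs) (here _)   = xs
  remove (x ∷ xs) (there y∈) = x ∷ remove xs y∈

  count-remove : ∀ (p : A → Bool) {y} → p y ≡ true → (xs : List A) (y∈ : y ∈ xs) →
    count p xs ≡ suc (count p (remove xs y∈))
  count-remove p py≡true (x ∷ xs) (here refl) rewrite py≡true = refl
  count-remove p py≡true (x ∷ xs) (there y∈) with p x
  ... | true  = cong suc (count-remove p py≡true xs y∈)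
  ... | false = count-remove p py≡true xs y∈

  ∈-remove : ∀ {y z : A} (xs : List A) → z ∈ xs → y ≢ z → (y∈ : y ∈ xs) → z ∈ remove xs y∈
  ∈-remove (x ∷ xs) (here refl) y≢z (here refl) = ⊥-elim (y≢z refl)
  ∈-remove (x ∷ xs) (there z∈)  y≢z (here refl) = z∈
  ∈-remove (x ∷ xs) (here refl) y≢z (there y∈)  = here refl
  ∈-remove (x ∷ xs) (there z∈)  y≢z (there y∈)  = there (∈-remove xs z∈ y≢z y∈)

  count-≥ : ∀ (p : A → Bool) (ys xs : List A) → Unique ys → (∀ y → y ∈ ys → y ∈ xs) →
    (∀ y → y ∈ ys → p y ≡ true) → length ys ≤ count p xs
  count-≥ p []       xs _            _    _ = z≤n
  count-≥ p (y ∷ ys) xs (y∉ys ∷ uniq) ys⊆xs ys-p = begin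
    suc (length ys)
      ≤⟨ s≤s (count-≥ p ys (remove xs y∈xs) uniq ys⊆rest (λ z z∈ → ys-p z (there z∈))) ⟩
    suc (count p (remove xs y∈xs))  ≡⟨ count-remove p (ys-p y (here refl)) xs y∈xs ⟨
    count p xs                      ∎
    where
    open ℕP.≤-Reasoning
    y∈xs : y ∈ xs
    y∈xs = ys⊆xs y (here refl)
    ys⊆rest : ∀ z → z ∈ ys → z ∈ remove xs y∈xs
    ys⊆rest z z∈ = ∈-remove xs (ys⊆xs z (there z∈)) (All.lookup y∉ys z∈) y∈xs

length-cartesianProductWith : ∀ {A B C : Set} (f : A → B → C) (xs : List A) (ys : List B) →
  length (cartesianProductWith f xs ys) ≡ length xs * length ys
length-cartesianProductWith f []       ys = refl
length-cartesianProductWith f (x ∷ xs) ys =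
  trans (length-++ (map (f x) ys)) (cong₂ _+_ (length-map (f x) ys) (length-cartesianProductWith f xs ys))

Point : Set
Point = ℤ × ℤ × ℤ

counted : Poly → Point → Bool
counted F t = normalised t ∧ (isPrimitive t ∧ onCurve F t)

grid-point : ℕ → ℕ → Point
grid-point a b = (+ suc a , + suc b , + 1)

grid-point-injective : ∀ {a a′ b b′} → grid-point a b ≡ grid-point a′ b′ → a ≡ a′ × b ≡ b′
grid-point-injective refl = refl , refl

grid : ℕ → List Point
grid n = cartesianProductWith grid-point (upTo n) (upTo n)

known-points : ℕ → List Point
known-points n = (+ 1 , + 0 , + 0) ∷ grid n

known-points-unique : ∀ n → Unique (known-points n)
known-points-unique n =
  All.tabulate (λ {t} t∈ → corner∉grid t t∈) ∷
  cartesianProductWith⁺ grid-point grid-point-injective (upTo⁺ n) (upTo⁺ n)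
  where
  corner∉grid : ∀ t → t ∈ grid n → (+ 1 , + 0 , + 0) ≢ t
  corner∉grid t t∈ with ∈-cartesianProductWith⁻ grid-point (upTo n) (upTo n) t∈
  ... | a , b , _ , _ , refl = λ ()

∈-range : ∀ B k → k ≤ B → + k ∈ range B
∈-range B k k≤B = ∈-++⁺ˡ (∈-map⁺ +_ (∈-upTo⁺ (s≤s k≤B)))

∈-triples : ∀ B {x y z} → x ≤ B → y ≤ B → z ≤ B → (+ x , + y , + z) ∈ triples B
∈-triples B {x} {y} {z} x≤B y≤B z≤B =
  ∈-concatMap (λ x → concatMap (λ y → map (λ z → x , y , z) (range B)) (range B)) (∈-range B x x≤B)
    (∈-concatMap (λ y → map (λ z → + x , y , z) (range B)) (∈-range B y y≤B)
      (∈-map⁺ (λ z → + x , + y , z) (∈-range B z z≤B)))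

known-points-counted : ∀ n t → t ∈ known-points n → counted (curve n) t ≡ true
known-points-counted n t (here refl) =
  cong₂ _∧_ (refl {x = true})
    (cong₂ _∧_ (dec-true (gcd (gcd 1 0) 0 ℕP.≟ 1) refl)
               (dec-true (_ ℚP.≟ 0ℚ) (corner-on-curve n)))
known-points-counted n t (there t∈) with ∈-cartesianProductWith⁻ grid-point (upTo n) (upTo n) t∈
... | a , b , a∈ , b∈ , refl =
  cong₂ _∧_ (refl {x = true})
    (cong₂ _∧_ (dec-true (gcd (gcd (suc a) (suc b)) 1 ℕP.≟ 1) (gcd-zeroʳ (gcd (suc a) (suc b))))
               (dec-true (_ ℚP.≟ 0ℚ) (grid-point-on-curve n a b (∈-upTo⁻ a∈) (∈-upTo⁻ b∈))))

known-points-bounded : ∀ n t → t ∈ known-points n → t ∈ triples (suc n)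
known-points-bounded n t (here refl) = ∈-triples (suc n) (s≤s z≤n) z≤n z≤n
known-points-bounded n t (there t∈) with ∈-cartesianProductWith⁻ grid-point (upTo n) (upTo n) t∈
... | a , b , a∈ , b∈ , refl =
  ∈-triples (suc n) (ℕP.<⇒≤ (s≤s (∈-upTo⁻ a∈))) (ℕP.<⇒≤ (s≤s (∈-upTo⁻ b∈))) (s≤s z≤n)

curve-point-count : ∀ n → suc (n * n) ≤ N (curve n) (suc n)
curve-point-count n = subst (_≤ N (curve n) (suc n)) length-known
  (count-≥ (counted (curve n)) (known-points n) (triples (suc n)) (known-points-unique n)
           (known-points-bounded n) (known-points-counted n))
  where
  length-known : length (known-points n) ≡ suc (n * n)
  length-known = cong suc (trans (length-cartesianProductWith grid-point (upTo n) (upTo n))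
                                 (cong₂ _*_ (length-upTo n) (length-upTo n)))

*-^ : ∀ a b k → (a * b) ^ k ≡ a ^ k * b ^ k
*-^ a b zero    = refl
*-^ a b (suc k) rewrite *-^ a b k =
  solve 4 (λ a b x y → a :* b :* (x :* y) := a :* x :* (b :* y)) refl a b (a ^ k) (b ^ k)
  where open NSolver

-- d² 2ᵈ ≤ 5ᵈ: the ratio 5ᵈ / (d² 2ᵈ) increases from d = 2 on.
square-pow2-≤-pow5 : ∀ d → d ^ 2 * 2 ^ d ≤ 5 ^ d
square-pow2-≤-pow5 0 = z≤n
square-pow2-≤-pow5 1 = ℕP.m≤m+n 2 3
square-pow2-≤-pow5 2 = ℕP.m≤m+n 16 9
square-pow2-≤-pow5 (suc (suc (suc m))) = begin
  (3 + m) ^ 2 * 2 ^ (3 + m)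
    ≡⟨ solve 2 (λ m P → (con 3 :+ m) :^ 2 :* (con 2 :* P) := (con 2 :* (con 3 :+ m) :^ 2) :* P) refl m (2 ^ (2 + m)) ⟩
  (2 * (3 + m) ^ 2) * 2 ^ (2 + m)  ≤⟨ ℕP.*-monoˡ-≤ (2 ^ (2 + m)) step ⟩
  (5 * (2 + m) ^ 2) * 2 ^ (2 + m)  ≡⟨ ℕP.*-assoc 5 ((2 + m) ^ 2) (2 ^ (2 + m)) ⟩
  5 * ((2 + m) ^ 2 * 2 ^ (2 + m))  ≤⟨ ℕP.*-monoʳ-≤ 5 (square-pow2-≤-pow5 (suc (suc m))) ⟩
  5 * 5 ^ (2 + m)                  ∎
  where
  open ℕP.≤-Reasoning
  open NSolver
  step : 2 * (3 + m) ^ 2 ≤ 5 * (2 + m) ^ 2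
  step = subst (2 * (3 + m) ^ 2 ≤_)
    (solve 1 (λ m → con 2 :* (con 3 :+ m) :^ 2 :+ (con 3 :* m :* m :+ con 8 :* m :+ con 2)
                 := con 5 :* (con 2 :+ m) :^ 2) refl m)
    (ℕP.m≤m+n (2 * (3 + m) ^ 2) (3 * m * m + 8 * m + 2))

-- (n + 1)² ≤ 2 (n² + 1), as (n + 1)² + (n - 1)² = 2 (n² + 1).
succ-square-≤ : ∀ n → suc n * suc n ≤ 2 * suc (n * n)
succ-square-≤ zero    = ℕP.m≤m+n 1 1
succ-square-≤ (suc m) = subst (suc (suc m) * suc (suc m) ≤_)
  (solve 1 (λ m → (con 2 :+ m) :* (con 2 :+ m) :+ m :* m := con 2 :* (con 1 :+ (con 1 :+ m) :* (con 1 :+ m)))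
     refl m)
  (ℕP.m≤m+n (suc (suc m) * suc (suc m)) (m * m))
  where open NSolver

-- With d = n + 1 and M ≥ n² + 1:  (d²)ᵈ d² ≤ (5M)ᵈ.  Multiplying by 2ᵈ,
-- 2ᵈ (d²)ᵈ d² ≤ (d²)ᵈ 5ᵈ = (5d²)ᵈ ≤ (10(n² + 1))ᵈ ≤ 2ᵈ (5M)ᵈ.
count-inequality : ∀ n M → suc (n * n) ≤ M → (suc n * suc n) ^ suc n * suc n ^ 2 ≤ (5 * M) ^ suc n
count-inequality n M n²+1≤M =
  ℕP.≤-trans (ℕP.*-cancelˡ-≤ (2 ^ d) {{ℕP.m^n≢0 2 d}} doubled) (ℕP.^-monoˡ-≤ d (ℕP.*-monoʳ-≤ 5 n²+1≤M))
  where
  d : ℕ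
  d = suc n
  open ℕP.≤-Reasoning
  doubled : 2 ^ d * ((d * d) ^ d * d ^ 2) ≤ 2 ^ d * (5 * suc (n * n)) ^ d
  doubled = begin
    2 ^ d * ((d * d) ^ d * d ^ 2)
      ≡⟨ solve 3 (λ A P D → A :* (P :* D) := P :* (D :* A)) refl (2 ^ d) ((d * d) ^ d) (d ^ 2) ⟩
    (d * d) ^ d * (d ^ 2 * 2 ^ d)  ≤⟨ ℕP.*-monoʳ-≤ ((d * d) ^ d) (square-pow2-≤-pow5 d) ⟩
    (d * d) ^ d * 5 ^ d            ≡⟨ ℕP.*-comm ((d * d) ^ d) (5 ^ d) ⟩
    5 ^ d * (d * d) ^ d            ≡⟨ *-^ 5 (d * d) d ⟨
    (5 * (d * d)) ^ d              ≤⟨ ℕP.^-monoˡ-≤ d (ℕP.*-monoʳ-≤ 5 (succ-square-≤ n)) ⟩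
    (5 * (2 * suc (n * n))) ^ d
      ≡⟨ cong (_^ d) (solve 1 (λ S → con 5 :* (con 2 :* S) := con 2 :* (con 5 :* S)) refl (suc (n * n))) ⟩
    (2 * (5 * suc (n * n))) ^ d    ≡⟨ *-^ 2 (5 * suc (n * n)) d ⟩
    2 ^ d * (5 * suc (n * n)) ^ d  ∎
    where open NSolver

proposition5 : (d : ℕ) → 0 < d →
    ∃ λ (F : Poly) → ∃ λ (B : ℕ) →
    Irreducible F × HomogeneousOfDegree d F × 1 ≤ B ×
    ((d * d) ^ d) * (B ^ 2) ≤ (5 * N F B) ^ d
proposition5 zero    ()
proposition5 (suc n) _ =
  curve n , suc n ,
  curve-irreducible n ,
  ((n , 1 , 0 , x₀ⁿx₁∈curve n) , λ i j k ≢0 → curve-homogeneous n (i , j , k) ≢0) ,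
  s≤s z≤n ,
  count-inequality n (N (curve n) (suc n)) (curve-point-count n)
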